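{- Let $P$ be a finite poset and let $T$ be a triangular $2$-face of $\mathcal{C}(P)$. Then there are unique antichains $A,B,C$ of $P$ such that $T=\operatorname{conv}(\chi_A,\chi_B,\chi_C)$, $A=\min(A\cup B\cup C)$ and $C=\max(A\cup B\cup C)$. Furthermore, in this case $A\cap C\subseteq B$.
   Context: For a finite poset $P$, the chain polytope is $\mathcal{C}(P)=\{x\in\mathbb{R}^P: x_p\ge 0 \text{ for all } p,\ x_{p_1}+\dots+x_{p_k}\le 1 \text{ whenever } p_1<\dots<p_k \text{ in } P\}$; its vertices are the characteristic vectors $\chi_A$ of antichains $A$ of $P$. A triangular face is a $2$-face with exactly three vertices. For $S\subseteq P$, $\min(S)$ and $\max(S)$ are the sets of minimal and maximal elements of $S$. -}

module Defs where

open import Data.Nat using (ℕ)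
open import Data.Fin using (Fin)
open import Data.Fin.Subset using (Subset; _∈_; _∪_; inside; outside)
open import Data.Integer using (ℤ; _+_; _≤_; 0ℤ)
open import Data.Vec using (lookup)
open import Data.List using (List; map; foldr; allFin)
open import Data.Product using (Σ; _×_; _,_)
open import Data.Sum using (_⊎_)
open import Data.Empty using (⊥)
open import Relation.Nullary using (¬_)
open import Relation.Binary.PropositionalEquality using (_≡_; _≢_)
open import Relation.Binary.Structures using (IsDecPartialOrder)
open import Function.Bundles using (_⇔_)

record FinPoset : Set₁ where
  field
    size : ℕ
    _≼_  : Fin size → Fin size → Set
    isDecPartialOrder : IsDecPartialOrder _≡_ _≼_

module _ (P : FinPoset) where
  open FinPoset P

  _≺_ : Fin size → Fin size → Set
  i ≺ j = (i ≼ j) × (i ≢ j)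

  Antichain : Subset size → Set
  Antichain A = ∀ i j → i ∈ A → j ∈ A → ¬ (i ≺ j)

  IsMinOf : Subset size → Subset size → Set
  IsMinOf A S = ∀ i → (i ∈ A) ⇔ ((i ∈ S) × (∀ j → j ∈ S → ¬ (j ≺ i)))

  IsMaxOf : Subset size → Subset size → Set
  IsMaxOf C S = ∀ i → (i ∈ C) ⇔ ((i ∈ S) × (∀ j → j ∈ S → ¬ (i ≺ j)))

  -- linear functional w evaluated at the characteristic vector χ_A

  pairing : (Fin size → ℤ) → Subset size → ℤ
  pairing w A = foldr _+_ 0ℤ (map (λ i → sel (lookup A i) (w i)) (allFin size))
    where
      sel : _ → ℤ → ℤ
      sel inside  x = x
      sel outside x = 0ℤ

  -- The vertices of C(P) are the χ_A for antichains A.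
  -- A is a vertex of the face of C(P) cut out (maximised) by the linear functional w.
  VertexOfFace : (Fin size → ℤ) → Subset size → Set
  VertexOfFace w A = Antichain A × (∀ B → Antichain B → pairing w B ≤ pairing w A)

  TriangularFace : (Fin size → ℤ) → Set
  TriangularFace w =
    Σ (Subset size) λ X → Σ (Subset size) λ Y → Σ (Subset size) λ Z →
      (X ≢ Y) × (Y ≢ Z) × (X ≢ Z) ×
      VertexOfFace w X × VertexOfFace w Y × VertexOfFace w Z ×
      (∀ D → VertexOfFace w D → (D ≡ X) ⊎ (D ≡ Y) ⊎ (D ≡ Z))

  -- T = conv(χ_A, χ_B, χ_C) for the face F_w: its vertex set is exactly {χ_A, χ_B, χ_C}
  FaceIsConv : (Fin size → ℤ) → Subset size → Subset size → Subset size → Set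
  FaceIsConv w A B C = ∀ D → VertexOfFace w D ⇔ ((D ≡ A) ⊎ (D ≡ B) ⊎ (D ≡ C))

  GoodTriple : (Fin size → ℤ) → Subset size → Subset size → Subset size → Set
  GoodTriple w A B C =
    Antichain A × Antichain B × Antichain C ×
    FaceIsConv w A B C ×
    IsMinOf A (A ∪ B ∪ C) × IsMaxOf C (A ∪ B ∪ C)

-- A face of C(P) consists of the antichains maximising a weight w. Every element of a vertex has
-- weight ≥ 0, and an element that can be added to a vertex has weight ≤ 0. The union of two
-- antichains A, B contains no 3-chain, so each of its elements is minimal or maximal in A ∪ B, and
-- the common ones are both; hence ⟨w,χ_A⟩ + ⟨w,χ_B⟩ ≤ ⟨w,χ_min(A∪B)⟩ + ⟨w,χ_max(A∪B)⟩, and for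
-- vertices A, B both min(A ∪ B) and max(A ∪ B) are vertices again. Applied twice, min U and max U
-- are vertices for the union U of the three vertices X, Y, Z of a triangle. They differ: otherwise
-- U is an antichain, and then X ⊕ Y ⊕ Z (the elements lying in an odd number of X, Y, Z) is a
-- fourth vertex. So the vertex set is {min U, B, max U} for a unique B. Finally, an element p of
-- min U ∩ max U outside B is incomparable to all of B, so w p ≤ 0; then min U - p and max U - p
-- are vertices, both equal to B, which forces min U = max U.

module Submission where

open import Algebra.Bundles using (CommutativeRing)
open import Data.Bool using (true; false; _xor_)
open import Data.Bool.Properties using (¬-not; xor-∧-commutativeRing)
open import Data.Empty using (⊥)
open import Data.Fin using (Fin; zero; suc; _≟_)
open import Data.Fin.Induction using (spo-wellFounded)
open import Data.Fin.Properties using (all?; any?)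
open import Data.Fin.Subset using (Subset; _∈_; _∉_; _⊆_; _∪_; _∩_; _-_; ⁅_⁆; outside)
open import Data.Fin.Subset.Properties
  using (_∈?_; ⊆-antisym; ∪-assoc; x∈p∩q⁻; x∈p∪q⁺; x∈p∪q⁻; x∈⁅x⁆; x∈⁅y⁆⇒x≡y; x∈p∧x≢y⇒x∈p-y; p─q⊆p)
open import Data.Integer using (ℤ; _+_; _≤_; _<_; 0ℤ)
open import Data.Integer.Properties
  using ( ≤-refl; ≤-trans; <⇒≤; ≮⇒≥; <⇒≱; +-identityʳ; +-identityˡ; +-commutativeSemigroup
        ; +-mono-≤; +-monoʳ-≤; +-monoˡ-≤; +-mono-<-≤; +-mono-≤-< )
open import Data.List using (List; []; _∷_; foldr; map; allFin)
open import Data.List.Membership.Propositional using (lose)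
open import Data.List.Membership.Propositional.Properties using (∈-allFin)
open import Data.List.Relation.Unary.Any using (Any; here; there)
open import Data.Nat using (ℕ)
open import Data.Product using (Σ; ∃-syntax; _×_; _,_; proj₁; proj₂)
open import Data.Sum using (_⊎_; inj₁; inj₂)
open import Data.Vec using (_∷_; there; lookup; tabulate; zipWith)
open import Data.Vec.Properties using (lookup∘tabulate; lookup-zipWith; []=⇒lookup; lookup⇒[]=)
open import Data.Vec.Relation.Binary.Pointwise.Extensional using (ext; Pointwise-≡⇒≡)
open import Function using (_∘_; flip; id)
open import Function.Bundles using (_⇔_; mk⇔; Equivalence)
import Function.Properties.Equivalence as ⇔
open import Induction.WellFounded using (Acc; acc)
open import Level using (Level)
open import Relation.Binary using (Rel) renaming (Decidable to Decidable₂)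
import Relation.Binary.Construct.Flip.EqAndOrd as Flip
import Relation.Binary.Construct.NonStrictToStrict as ToStrict
open import Relation.Binary.PropositionalEquality
  using (_≡_; _≢_; refl; sym; trans; cong; cong₂; subst; subst₂; module ≡-Reasoning)
open import Relation.Binary.Structures using (IsStrictPartialOrder; IsDecPartialOrder)
open import Relation.Nullary using (¬_; yes; no; does; contradiction)
open import Relation.Nullary.Decidable using (dec-true; _×-dec_; _→-dec_; ¬?)
open import Relation.Unary using (Pred; Decidable)

open import Algebra.Properties.CommutativeSemigroup +-commutativeSemigroup using (interchange)
open import Algebra.Properties.CommutativeSemigroup
  (CommutativeRing.+-commutativeSemigroup xor-∧-commutativeRing) using (x∙yz≈y∙xz; x∙yz≈z∙xy)

open import Defs

open Equivalence using (to; from)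

private
  variable
    a ℓ : Level
    A : Set a
    n : ℕ

∑ : (A → ℤ) → List A → ℤ
∑ f xs = foldr _+_ 0ℤ (map f xs)

module _ {f g : A → ℤ} (f≤g : ∀ x → f x ≤ g x) where

  ∑-mono-≤ : ∀ xs → ∑ f xs ≤ ∑ g xs
  ∑-mono-≤ []       = ≤-refl
  ∑-mono-≤ (x ∷ xs) = +-mono-≤ (f≤g x) (∑-mono-≤ xs)

  ∑-mono-< : ∀ {xs} → Any (λ x → f x < g x) xs → ∑ f xs < ∑ g xs
  ∑-mono-< {_ ∷ xs} (here fx<gx) = +-mono-<-≤ fx<gx (∑-mono-≤ xs)
  ∑-mono-< {x ∷ _}  (there f<g)  = +-mono-≤-< (f≤g x) (∑-mono-< f<g)

∑-+ : ∀ (f g : A → ℤ) xs → ∑ (λ x → f x + g x) xs ≡ ∑ f xs + ∑ g xs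
∑-+ f g []       = refl
∑-+ f g (x ∷ xs) = trans (cong (f x + g x +_) (∑-+ f g xs)) (interchange (f x) (g x) (∑ f xs) (∑ g xs))

≤-+-squeeze : ∀ {a b c d : ℤ} → c ≤ a → d ≤ b → a + b ≤ c + d → a ≤ c × b ≤ d
≤-+-squeeze c≤a d≤b ab≤cd =
  ≮⇒≥ (λ c<a → <⇒≱ (+-mono-<-≤ c<a d≤b) ab≤cd) , ≮⇒≥ (λ d<b → <⇒≱ (+-mono-≤-< c≤a d<b) ab≤cd)

Among : A → A → A → A → Set _
Among x y z d = d ≡ x ⊎ d ≡ y ⊎ d ≡ z

pattern 1st = inj₁ refl
pattern 2nd = inj₂ (inj₁ refl)
pattern 3rd = inj₂ (inj₂ refl)

Among-elim : ∀ {p} (P : A → Set p) {x y z d} → P x → P y → P z → Among x y z d → P d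
Among-elim P px py pz 1st = px
Among-elim P px py pz 2nd = py
Among-elim P px py pz 3rd = pz

Among-⇔ : ∀ {x y z a b c : A} → Among a b c x → Among a b c y → Among a b c z →
          Among x y z a → Among x y z b → Among x y z c → ∀ {d} → Among x y z d ⇔ Among a b c d
Among-⇔ {a = a} {b} {c} x∈ y∈ z∈ a∈ b∈ c∈ =
  mk⇔ (Among-elim (Among a b c) x∈ y∈ z∈) (Among-elim _ a∈ b∈ c∈)

Among-third : ∀ {x y z a c : A} → x ≢ y → y ≢ z → x ≢ z → Among x y z a → Among x y z c → a ≢ c →
              ∃[ b ] b ≢ a × b ≢ c × (∀ {d} → Among x y z d ⇔ Among a b c d)
Among-third x≢y y≢z x≢z 1st 1st a≢c = contradiction refl a≢c
Among-third x≢y y≢z x≢z 2nd 2nd a≢c = contradiction refl a≢c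
Among-third x≢y y≢z x≢z 3rd 3rd a≢c = contradiction refl a≢c
Among-third x≢y y≢z x≢z 1st 2nd _   = _ , x≢z ∘ sym , y≢z ∘ sym , Among-⇔ 1st 3rd 2nd 1st 3rd 2nd
Among-third x≢y y≢z x≢z 1st 3rd _   = _ , x≢y ∘ sym , y≢z       , Among-⇔ 1st 2nd 3rd 1st 2nd 3rd
Among-third x≢y y≢z x≢z 2nd 1st _   = _ , y≢z ∘ sym , x≢z ∘ sym , Among-⇔ 3rd 1st 2nd 2nd 3rd 1st
Among-third x≢y y≢z x≢z 2nd 3rd _   = _ , x≢y       , x≢z       , Among-⇔ 2nd 1st 3rd 2nd 1st 3rd
Among-third x≢y y≢z x≢z 3rd 1st _   = _ , y≢z       , x≢y ∘ sym , Among-⇔ 3rd 2nd 1st 3rd 2nd 1st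
Among-third x≢y y≢z x≢z 3rd 2nd _   = _ , x≢z       , x≢y       , Among-⇔ 2nd 3rd 1st 3rd 1st 2nd

∈-∪₃⁺ : ∀ {X Y Z D : Subset n} {i} → Among X Y Z D → i ∈ D → i ∈ X ∪ Y ∪ Z
∈-∪₃⁺ 1st i∈X = x∈p∪q⁺ (inj₁ i∈X)
∈-∪₃⁺ 2nd i∈Y = x∈p∪q⁺ (inj₂ (x∈p∪q⁺ (inj₁ i∈Y)))
∈-∪₃⁺ 3rd i∈Z = x∈p∪q⁺ (inj₂ (x∈p∪q⁺ (inj₂ i∈Z)))

∈-∪₃⁻ : ∀ (X Y Z : Subset n) {i} → i ∈ X ∪ Y ∪ Z → ∃[ D ] Among X Y Z D × i ∈ D
∈-∪₃⁻ X Y Z i∈ with x∈p∪q⁻ X (Y ∪ Z) i∈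
... | inj₁ i∈X = X , 1st , i∈X
... | inj₂ i∈Y∪Z with x∈p∪q⁻ Y Z i∈Y∪Z
...   | inj₁ i∈Y = Y , 2nd , i∈Y
...   | inj₂ i∈Z = Z , 3rd , i∈Z

∪₃-⊆ : ∀ {X Y Z A B C : Subset n} → (∀ {D} → Among X Y Z D → Among A B C D) → X ∪ Y ∪ Z ⊆ A ∪ B ∪ C
∪₃-⊆ {X = X} {Y} {Z} sub i∈ with ∈-∪₃⁻ X Y Z i∈
... | _ , D∈ , i∈D = ∈-∪₃⁺ (sub D∈) i∈D

∪₃-cong : ∀ {X Y Z A B C : Subset n} → (∀ {D} → Among X Y Z D ⇔ Among A B C D) → X ∪ Y ∪ Z ≡ A ∪ B ∪ C
∪₃-cong same = ⊆-antisym (∪₃-⊆ (to same)) (∪₃-⊆ (from same))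

x∉p-x : ∀ {p : Subset n} x → x ∉ p - x
x∉p-x {p = _ ∷ _} zero    ()
x∉p-x {p = _ ∷ _} (suc x) (there x∈) = x∉p-x x x∈

x∈p∧x∉p-y⇒x≡y : ∀ {p : Subset n} {x y} → x ∈ p → x ∉ p - y → x ≡ y
x∈p∧x∉p-y⇒x≡y {x = x} {y} x∈p x∉p-y with x ≟ y
... | yes x≡y = x≡y
... | no x≢y  = contradiction (x∈p∧x≢y⇒x∈p-y x∈p x≢y) x∉p-y

x∉p∧x∈p∪⁅y⁆⇒x≡y : ∀ {p : Subset n} {x y} → x ∉ p → x ∈ p ∪ ⁅ y ⁆ → x ≡ y
x∉p∧x∈p∪⁅y⁆⇒x≡y {p = p} {y = y} x∉p x∈ with x∈p∪q⁻ p ⁅ y ⁆ x∈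
... | inj₁ x∈p = contradiction x∈p x∉p
... | inj₂ x∈y = x∈⁅y⁆⇒x≡y y x∈y

p⊆q∧x∈q⇒p∪⁅x⁆⊆q : ∀ {p q : Subset n} {x} → p ⊆ q → x ∈ q → p ∪ ⁅ x ⁆ ⊆ q
p⊆q∧x∈q⇒p∪⁅x⁆⊆q {p = p} {q} {x} p⊆q x∈q y∈ with x∈p∪q⁻ p ⁅ x ⁆ y∈
... | inj₁ y∈p = p⊆q y∈p
... | inj₂ y∈x = subst (_∈ q) (sym (x∈⁅y⁆⇒x≡y x y∈x)) x∈q

x∈q∧p-x⊆q-x⇒p⊆q : ∀ {p q : Subset n} {x} → x ∈ q → p - x ⊆ q - x → p ⊆ q
x∈q∧p-x⊆q-x⇒p⊆q {x = x} x∈q p-x⊆q-x {y} y∈p with y ≟ x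
... | yes refl = x∈q
... | no y≢x   = p─q⊆p _ _ (p-x⊆q-x (x∈p∧x≢y⇒x∈p-y y∈p y≢x))

x∈p∧x∈q∧p-x≡q-x⇒p≡q : ∀ {p q : Subset n} {x} → x ∈ p → x ∈ q → p - x ≡ q - x → p ≡ q
x∈p∧x∈q∧p-x≡q-x⇒p≡q x∈p x∈q eq =
  ⊆-antisym (x∈q∧p-x⊆q-x⇒p⊆q x∈q (subst (_ ⊆_) eq id)) (x∈q∧p-x⊆q-x⇒p⊆q x∈p (subst (_⊆ _) eq id))

_⊕_ : Subset n → Subset n → Subset n
_⊕_ = zipWith _xor_

infixr 6 _⊕_

xor-collapseˡ : ∀ x y z → x xor y xor z ≡ x → y ≡ z
xor-collapseˡ _     false false _ = refl
xor-collapseˡ _     true  true  _ = refl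
xor-collapseˡ false false true  ()
xor-collapseˡ false true  false ()
xor-collapseˡ true  false true  ()
xor-collapseˡ true  true  false ()

xor-collapseᵐ : ∀ x y z → x xor y xor z ≡ y → x ≡ z
xor-collapseᵐ x y z e = xor-collapseˡ y x z (trans (sym (x∙yz≈y∙xz x y z)) e)

xor-collapseʳ : ∀ x y z → x xor y xor z ≡ z → x ≡ y
xor-collapseʳ x y z e = xor-collapseˡ z x y (trans (sym (x∙yz≈z∙xy x y z)) e)

module _ (X Y Z : Subset n) where

  lookup-⊕₃ : ∀ i → lookup (X ⊕ Y ⊕ Z) i ≡ lookup X i xor lookup Y i xor lookup Z i
  lookup-⊕₃ i = trans (lookup-zipWith _ i X (Y ⊕ Z)) (cong (lookup X i xor_) (lookup-zipWith _ i Y Z))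

  ⊕₃⊆∪₃ : X ⊕ Y ⊕ Z ⊆ X ∪ Y ∪ Z
  ⊕₃⊆∪₃ {i} i∈ with i ∈? X | i ∈? Y | i ∈? Z
  ... | yes i∈X | _       | _       = ∈-∪₃⁺ 1st i∈X
  ... | no _    | yes i∈Y | _       = ∈-∪₃⁺ 2nd i∈Y
  ... | no _    | no _    | yes i∈Z = ∈-∪₃⁺ 3rd i∈Z
  ... | no i∉X  | no i∉Y  | no i∉Z  = contradiction (begin
    true                                      ≡⟨ []=⇒lookup i∈ ⟨
    lookup (X ⊕ Y ⊕ Z) i                      ≡⟨ lookup-⊕₃ i ⟩
    lookup X i xor lookup Y i xor lookup Z i
      ≡⟨ cong₂ _xor_ (∉⇒outside i∉X) (cong₂ _xor_ (∉⇒outside i∉Y) (∉⇒outside i∉Z)) ⟩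
    false                                     ∎) λ ()
    where
      open ≡-Reasoning
      ∉⇒outside : ∀ {p : Subset n} {i} → i ∉ p → lookup p i ≡ outside
      ∉⇒outside {p} {i} i∉p = ¬-not (i∉p ∘ lookup⇒[]= i p)

  ∩₃⊆⊕₃ : ∀ {i} → i ∈ X → i ∈ Y → i ∈ Z → i ∈ X ⊕ Y ⊕ Z
  ∩₃⊆⊕₃ {i} i∈X i∈Y i∈Z = lookup⇒[]= i _ (trans (lookup-⊕₃ i)
    (cong₂ _xor_ ([]=⇒lookup i∈X) (cong₂ _xor_ ([]=⇒lookup i∈Y) ([]=⇒lookup i∈Z))))

  private
    collapse : ∀ {S T T′ : Subset n} →
               (∀ i → lookup X i xor lookup Y i xor lookup Z i ≡ lookup S i → lookup T i ≡ lookup T′ i) →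
               X ⊕ Y ⊕ Z ≡ S → T ≡ T′
    collapse pointwise refl = Pointwise-≡⇒≡ (ext λ i → pointwise i (sym (lookup-⊕₃ i)))

  ⊕₃-∉ : X ≢ Y → Y ≢ Z → X ≢ Z → ¬ Among X Y Z (X ⊕ Y ⊕ Z)
  ⊕₃-∉ X≢Y Y≢Z X≢Z (inj₁ D≡X)        = Y≢Z (collapse (λ _ → xor-collapseˡ _ _ _) D≡X)
  ⊕₃-∉ X≢Y Y≢Z X≢Z (inj₂ (inj₁ D≡Y)) = X≢Z (collapse (λ _ → xor-collapseᵐ _ _ _) D≡Y)
  ⊕₃-∉ X≢Y Y≢Z X≢Z (inj₂ (inj₂ D≡Z)) = X≢Y (collapse (λ _ → xor-collapseʳ _ _ _) D≡Z)

fromDec : {P : Pred (Fin n) ℓ} → Decidable P → Subset n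
fromDec P? = tabulate (does ∘ P?)

∈-fromDec : {P : Pred (Fin n) ℓ} (P? : Decidable P) {i : Fin n} → i ∈ fromDec P? ⇔ P i
∈-fromDec {P = P} P? {i} =
  mk⇔ witness λ Pi → lookup⇒[]= i _ (trans (lookup∘tabulate _ i) (dec-true (P? i) Pi))
  where
    witness : i ∈ fromDec P? → P i
    witness i∈ with P? i | trans (sym (lookup∘tabulate _ i)) ([]=⇒lookup i∈)
    ... | yes Pi | _ = Pi
    ... | no _   | ()

module Extremal {_<_ : Rel (Fin n) ℓ} (isSPO : IsStrictPartialOrder _≡_ _<_) (_<?_ : Decidable₂ _<_) where
  open IsStrictPartialOrder isSPO public using () renaming (trans to <-trans)

  IsMinimal : Subset n → Pred (Fin n) ℓ
  IsMinimal S i = i ∈ S × (∀ j → j ∈ S → ¬ j < i)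

  isMinimal? : ∀ S → Decidable (IsMinimal S)
  isMinimal? S i = i ∈? S ×-dec all? λ j → j ∈? S →-dec ¬? (j <? i)

  minimals : Subset n → Subset n
  minimals S = fromDec (isMinimal? S)

  ∈-minimals : ∀ {S i} → i ∈ minimals S ⇔ IsMinimal S i
  ∈-minimals = ∈-fromDec (isMinimal? _)

  minimals-⊆ : ∀ {S} → minimals S ⊆ S
  minimals-⊆ = proj₁ ∘ to ∈-minimals

  minimals-unique : ∀ {A S} → (∀ i → i ∈ A ⇔ IsMinimal S i) → A ≡ minimals S
  minimals-unique A⇔ = ⊆-antisym (from ∈-minimals ∘ to (A⇔ _)) (from (A⇔ _) ∘ to ∈-minimals)

  IsMinimal-⊆ : ∀ {S T i} → S ⊆ T → i ∈ S → IsMinimal T i → IsMinimal S i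
  IsMinimal-⊆ S⊆T i∈S (_ , i-min) = i∈S , λ j → i-min j ∘ S⊆T

  minimal-below : ∀ {S i} → i ∈ S → ∃[ j ] IsMinimal S j × (j ≡ i ⊎ j < i)
  minimal-below {S} i∈S = go (spo-wellFounded isSPO _) i∈S
    where
      go : ∀ {i} → Acc _<_ i → i ∈ S → ∃[ j ] IsMinimal S j × (j ≡ i ⊎ j < i)
      go {i} (acc below) i∈S with any? (λ j → j ∈? S ×-dec j <? i)
      ... | no ∄smaller = i , (i∈S , λ j j∈S j<i → ∄smaller (j , j∈S , j<i)) , inj₁ refl
      ... | yes (j , j∈S , j<i) with go (below j<i) j∈S
      ...   | k , k-min , inj₁ refl = k , k-min , inj₂ j<i
      ...   | k , k-min , inj₂ k<j  = k , k-min , inj₂ (<-trans k<j j<i)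

  minimals-∪ : ∀ S T → minimals (minimals S ∪ T) ≡ minimals (S ∪ T)
  minimals-∪ S T = minimals-unique λ i → ⇔.trans ∈-minimals (mk⇔ reduce extend)
    where
      m∪T⊆S∪T : minimals S ∪ T ⊆ S ∪ T
      m∪T⊆S∪T i∈ with x∈p∪q⁻ (minimals S) T i∈
      ... | inj₁ i∈m = x∈p∪q⁺ (inj₁ (minimals-⊆ i∈m))
      ... | inj₂ i∈T = x∈p∪q⁺ (inj₂ i∈T)

      reduce : ∀ {i} → IsMinimal (minimals S ∪ T) i → IsMinimal (S ∪ T) i
      reduce {i} (i∈ , i-min) = m∪T⊆S∪T i∈ , no-smaller
        where
          no-smaller : ∀ j → j ∈ S ∪ T → ¬ j < i
          no-smaller j j∈ j<i with x∈p∪q⁻ S T j∈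
          ... | inj₂ j∈T = i-min j (x∈p∪q⁺ (inj₂ j∈T)) j<i
          ... | inj₁ j∈S with minimal-below j∈S
          ...   | k , k-min , k≤j = i-min k (x∈p∪q⁺ (inj₁ (from ∈-minimals k-min))) (k<i k≤j)
            where
              k<i : k ≡ j ⊎ k < j → k < i
              k<i (inj₁ refl) = j<i
              k<i (inj₂ k<j)  = <-trans k<j j<i

      extend : ∀ {i} → IsMinimal (S ∪ T) i → IsMinimal (minimals S ∪ T) i
      extend {i} i-min@(i∈ , _) = IsMinimal-⊆ m∪T⊆S∪T i∈m∪T i-min
        where
          i∈m∪T : i ∈ minimals S ∪ T
          i∈m∪T with x∈p∪q⁻ S T i∈
          ... | inj₁ i∈S = x∈p∪q⁺ (inj₁ (from ∈-minimals (IsMinimal-⊆ (x∈p∪q⁺ ∘ inj₁) i∈S i-min)))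
          ... | inj₂ i∈T = x∈p∪q⁺ (inj₂ i∈T)

  minimals-∪₃ : ∀ S T U → minimals (minimals (S ∪ T) ∪ U) ≡ minimals (S ∪ T ∪ U)
  minimals-∪₃ S T U = trans (minimals-∪ (S ∪ T) U) (cong minimals (∪-assoc S T U))

module Order (P : FinPoset) where
  open FinPoset P
  open IsDecPartialOrder isDecPartialOrder using (isPartialOrder; _≤?_)

  _⊏_ : Rel (Fin size) _
  _⊏_ = _≺_ P

  ⊏-isStrictPartialOrder : IsStrictPartialOrder _≡_ _⊏_
  ⊏-isStrictPartialOrder = ToStrict.<-isStrictPartialOrder _≡_ _≼_ isPartialOrder

  _⊏?_ : Decidable₂ _⊏_
  _⊏?_ = ToStrict.<-decidable _≡_ _≼_ _≟_ _≤?_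

  module Min = Extremal ⊏-isStrictPartialOrder _⊏?_
  module Max = Extremal (Flip.isStrictPartialOrder ⊏-isStrictPartialOrder) (flip _⊏?_)

  minimals maximals : Subset size → Subset size
  minimals = Min.minimals
  maximals = Max.minimals

  antichain-⊆ : ∀ {A B} → A ⊆ B → Antichain P B → Antichain P A
  antichain-⊆ A⊆B B-anti i j i∈A j∈A = B-anti i j (A⊆B i∈A) (A⊆B j∈A)

  minimals-antichain : ∀ S → Antichain P (minimals S)
  minimals-antichain S i j i∈ j∈ = proj₂ (to Min.∈-minimals j∈) i (Min.minimals-⊆ i∈)

  maximals-antichain : ∀ S → Antichain P (maximals S)
  maximals-antichain S i j i∈ j∈ = proj₂ (to Max.∈-minimals i∈) j (Max.minimals-⊆ j∈)

  antichain-∪⁅isolated⁆ : ∀ {B S p} → Antichain P B → B ⊆ S → Min.IsMinimal S p → Max.IsMinimal S p →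
                          Antichain P (B ∪ ⁅ p ⁆)
  antichain-∪⁅isolated⁆ {B} {S} {p} B-anti B⊆S (_ , p-min) (_ , p-max) i j i∈ j∈ i⊏j
    with x∈p∪q⁻ B ⁅ p ⁆ i∈ | x∈p∪q⁻ B ⁅ p ⁆ j∈
  ... | inj₁ i∈B | inj₁ j∈B = B-anti i j i∈B j∈B i⊏j
  ... | inj₁ i∈B | inj₂ j∈p with refl ← x∈⁅y⁆⇒x≡y p j∈p = p-min i (B⊆S i∈B) i⊏j
  ... | inj₂ i∈p | inj₁ j∈B with refl ← x∈⁅y⁆⇒x≡y p i∈p = p-max j (B⊆S j∈B) i⊏j
  ... | inj₂ i∈p | inj₂ j∈p = proj₂ i⊏j (trans (x∈⁅y⁆⇒x≡y p i∈p) (sym (x∈⁅y⁆⇒x≡y p j∈p)))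

  module _ {A B} (A-anti : Antichain P A) (B-anti : Antichain P B) where

    ∪-no-3-chain : ∀ {i j k} → i ∈ A ∪ B → j ∈ A ∪ B → k ∈ A ∪ B → i ⊏ j → j ⊏ k → ⊥
    ∪-no-3-chain {i} {j} {k} i∈ j∈ k∈ i⊏j j⊏k with x∈p∪q⁻ A B i∈ | x∈p∪q⁻ A B j∈ | x∈p∪q⁻ A B k∈
    ... | inj₁ i∈A | inj₁ j∈A | _        = A-anti i j i∈A j∈A i⊏j
    ... | inj₂ i∈B | inj₂ j∈B | _        = B-anti i j i∈B j∈B i⊏j
    ... | _        | inj₁ j∈A | inj₁ k∈A = A-anti j k j∈A k∈A j⊏k
    ... | _        | inj₂ j∈B | inj₂ k∈B = B-anti j k j∈B k∈B j⊏k
    ... | inj₁ i∈A | inj₂ _   | inj₁ k∈A = A-anti i k i∈A k∈A (Min.<-trans i⊏j j⊏k)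
    ... | inj₂ i∈B | inj₁ _   | inj₂ k∈B = B-anti i k i∈B k∈B (Min.<-trans i⊏j j⊏k)

    ∪-⊆-minimals∪maximals : ∀ {i} → i ∈ A ∪ B → i ∈ minimals (A ∪ B) ⊎ i ∈ maximals (A ∪ B)
    ∪-⊆-minimals∪maximals i∈ with Min.minimal-below i∈
    ... | _ , i-min , inj₁ refl = inj₁ (from Min.∈-minimals i-min)
    ... | j , (j∈ , _) , inj₂ j⊏i =
      inj₂ (from Max.∈-minimals (i∈ , λ k k∈ i⊏k → ∪-no-3-chain j∈ i∈ k∈ j⊏i i⊏k))

    ∩-⊆-minimals∩maximals : ∀ {i} → i ∈ A → i ∈ B → i ∈ minimals (A ∪ B) × i ∈ maximals (A ∪ B)
    ∩-⊆-minimals∩maximals {i} i∈A i∈B =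
      from Min.∈-minimals (i∈ , λ j j∈ j⊏i → incomparable j∈ (inj₁ j⊏i)) ,
      from Max.∈-minimals (i∈ , λ j j∈ i⊏j → incomparable j∈ (inj₂ i⊏j))
      where
        i∈ = x∈p∪q⁺ (inj₁ i∈A)
        incomparable : ∀ {j} → j ∈ A ∪ B → ¬ (j ⊏ i ⊎ i ⊏ j)
        incomparable j∈ j~i with x∈p∪q⁻ A B j∈ | j~i
        ... | inj₁ j∈A | inj₁ j⊏i = A-anti _ _ j∈A i∈A j⊏i
        ... | inj₁ j∈A | inj₂ i⊏j = A-anti _ _ i∈A j∈A i⊏j
        ... | inj₂ j∈B | inj₁ j⊏i = B-anti _ _ j∈B i∈B j⊏i
        ... | inj₂ j∈B | inj₂ i⊏j = B-anti _ _ i∈B j∈B i⊏j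

  minimals≡maximals⇒antichain : ∀ {S} → minimals S ≡ maximals S → Antichain P S
  minimals≡maximals⇒antichain {S} m≡M i j i∈ j∈ i⊏j with Min.minimal-below i∈ | Max.minimal-below j∈
  ... | k , k-min , k≤i | l , l-max , j≤l =
    minimals-antichain S k l (from Min.∈-minimals k-min) l∈m (k⊏l k≤i j≤l)
    where
      l∈m : l ∈ minimals S
      l∈m = subst (l ∈_) (sym m≡M) (from Max.∈-minimals l-max)

      k⊏l : k ≡ i ⊎ k ⊏ i → l ≡ j ⊎ j ⊏ l → k ⊏ l
      k⊏l (inj₁ refl) (inj₁ refl) = i⊏j
      k⊏l (inj₁ refl) (inj₂ j⊏l)  = Min.<-trans i⊏j j⊏l
      k⊏l (inj₂ k⊏i)  (inj₁ refl) = Min.<-trans k⊏i i⊏j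
      k⊏l (inj₂ k⊏i)  (inj₂ j⊏l)  = Min.<-trans k⊏i (Min.<-trans i⊏j j⊏l)

module Face (P : FinPoset) (w : Fin (FinPoset.size P) → ℤ) where
  open FinPoset P using (size)
  open Order P

  Vertex : Subset size → Set
  Vertex = VertexOfFace P w

  -- wχ A i is the i-th summand of `pairing P w A`. That summand is local to a `where` block of Defs,
  -- so wχ is left as a meta, solved by unification while checking pairing-mono-≤.
  mutual
    wχ : Subset size → Fin size → ℤ
    wχ A = _

    pairing-mono-≤ : ∀ {A B} → (∀ i → wχ A i ≤ wχ B i) → pairing P w A ≤ pairing P w B
    pairing-mono-≤ wχ≤ = ∑-mono-≤ wχ≤ (allFin size)

  pairing-mono-< : ∀ {A B} p → (∀ i → wχ A i ≤ wχ B i) → wχ A p < wχ B p → pairing P w A < pairing P w B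
  pairing-mono-< p wχ≤ wχ< = ∑-mono-< wχ≤ (lose (∈-allFin p) wχ<)

  pairing-+-mono-≤ : ∀ {A B C D} → (∀ i → wχ A i + wχ B i ≤ wχ C i + wχ D i) →
                     pairing P w A + pairing P w B ≤ pairing P w C + pairing P w D
  pairing-+-mono-≤ {A} {B} {C} {D} wχ≤ =
    subst₂ _≤_ (∑-+ (wχ A) (wχ B) (allFin size)) (∑-+ (wχ C) (wχ D) (allFin size))
               (∑-mono-≤ wχ≤ (allFin size))

  wχ-∈ : ∀ {A i} → i ∈ A → wχ A i ≡ w i
  wχ-∈ i∈A rewrite []=⇒lookup i∈A = refl

  wχ-∉ : ∀ {A i} → i ∉ A → wχ A i ≡ 0ℤ
  wχ-∉ {A} {i} i∉A rewrite ¬-not (i∉A ∘ lookup⇒[]= i A) = refl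

  wχ-mono : ∀ {A B} i → (i ∈ A → i ∉ B → w i ≤ 0ℤ) → (i ∉ A → i ∈ B → 0ℤ ≤ w i) → wχ A i ≤ wχ B i
  wχ-mono {A} {B} i lost gained with i ∈? A | i ∈? B
  ... | yes i∈A | yes i∈B rewrite wχ-∈ i∈A | wχ-∈ i∈B = ≤-refl
  ... | yes i∈A | no i∉B  rewrite wχ-∈ i∈A | wχ-∉ i∉B = lost i∈A i∉B
  ... | no i∉A  | yes i∈B rewrite wχ-∉ i∉A | wχ-∈ i∈B = gained i∉A i∈B
  ... | no i∉A  | no i∉B  rewrite wχ-∉ i∉A | wχ-∉ i∉B = ≤-refl

  wχ-nonneg : ∀ {A} i → (i ∈ A → 0ℤ ≤ w i) → 0ℤ ≤ wχ A i
  wχ-nonneg {A} i w≥0 with i ∈? A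
  ... | yes i∈A rewrite wχ-∈ i∈A = w≥0 i∈A
  ... | no i∉A  rewrite wχ-∉ i∉A = ≤-refl

  wχ-minus : ∀ {A p} → w p ≤ 0ℤ → ∀ i → wχ A i ≤ wχ (A - p) i
  wχ-minus {A} {p} wp≤0 i = wχ-mono {A} {A - p} i
    (λ i∈A i∉ → subst (λ j → w j ≤ 0ℤ) (sym (x∈p∧x∉p-y⇒x≡y i∈A i∉)) wp≤0)
    (λ i∉A i∈ → contradiction (p─q⊆p _ _ i∈) i∉A)

  wχ-plus : ∀ {A p} → 0ℤ ≤ w p → ∀ i → wχ A i ≤ wχ (A ∪ ⁅ p ⁆) i
  wχ-plus {A} {p} wp≥0 i = wχ-mono {A} {A ∪ ⁅ p ⁆} i
    (λ i∈A i∉ → contradiction (x∈p∪q⁺ (inj₁ i∈A)) i∉)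
    (λ i∉A i∈ → subst (λ j → 0ℤ ≤ w j) (sym (x∉p∧x∈p∪⁅y⁆⇒x≡y i∉A i∈)) wp≥0)

  vertex-≤ : ∀ {A B} → Vertex A → Antichain P B → pairing P w A ≤ pairing P w B → Vertex B
  vertex-≤ (_ , A-opt) B-anti A≤B = B-anti , λ C C-anti → ≤-trans (A-opt C C-anti) A≤B

  vertex-≮ : ∀ {A B} p → Vertex A → Antichain P B → (∀ i → wχ A i ≤ wχ B i) → ¬ wχ A p < wχ B p
  vertex-≮ {A} {B} p (_ , A-opt) B-anti wχ≤ wχ< = <⇒≱ (pairing-mono-< {A} {B} p wχ≤ wχ<) (A-opt B B-anti)

  vertex-minus : ∀ {A p} → Vertex A → w p ≤ 0ℤ → Vertex (A - p)
  vertex-minus {A} {p} VA wp≤0 =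
    vertex-≤ {A} {A - p} VA (antichain-⊆ (p─q⊆p _ _) (proj₁ VA))
      (pairing-mono-≤ {A} {A - p} (wχ-minus {A} wp≤0))

  weight-nonneg : ∀ {A p} → Vertex A → p ∈ A → 0ℤ ≤ w p
  weight-nonneg {A} {p} VA p∈A = ≮⇒≥ λ wp<0 →
    vertex-≮ {A} {A - p} p VA (antichain-⊆ (p─q⊆p _ _) (proj₁ VA)) (wχ-minus {A} (<⇒≤ wp<0))
      (subst₂ _<_ (sym (wχ-∈ p∈A)) (sym (wχ-∉ {A - p} (x∉p-x p))) wp<0)

  weight-nonpos : ∀ {A p} → Vertex A → p ∉ A → Antichain P (A ∪ ⁅ p ⁆) → w p ≤ 0ℤ
  weight-nonpos {A} {p} VA p∉A A+p-anti = ≮⇒≥ λ wp>0 →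
    vertex-≮ {A} {A ∪ ⁅ p ⁆} p VA A+p-anti (wχ-plus {A} (<⇒≤ wp>0))
      (subst₂ _<_ (sym (wχ-∉ p∉A)) (sym (wχ-∈ {A ∪ ⁅ p ⁆} (x∈p∪q⁺ (inj₂ (x∈⁅x⁆ p))))) wp>0)

  module _ {A B} (A-anti : Antichain P A) (B-anti : Antichain P B) (w≥0 : ∀ {i} → i ∈ A ∪ B → 0ℤ ≤ w i) where
    private
      m = minimals (A ∪ B)
      M = maximals (A ∪ B)

      m≥0 : ∀ i → 0ℤ ≤ wχ m i
      m≥0 i = wχ-nonneg i (w≥0 ∘ Min.minimals-⊆)

      M≥0 : ∀ i → 0ℤ ≤ wχ M i
      M≥0 i = wχ-nonneg i (w≥0 ∘ Max.minimals-⊆)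

      covered : ∀ {i} → i ∈ A ∪ B → w i ≤ wχ m i + wχ M i
      covered {i} i∈ with ∪-⊆-minimals∪maximals A-anti B-anti i∈
      ... | inj₁ i∈m rewrite wχ-∈ i∈m = subst (_≤ w i + wχ M i) (+-identityʳ (w i)) (+-monoʳ-≤ (w i) (M≥0 i))
      ... | inj₂ i∈M rewrite wχ-∈ i∈M = subst (_≤ wχ m i + w i) (+-identityˡ (w i)) (+-monoˡ-≤ (w i) (m≥0 i))

    wχ-∪-≤-extremals : ∀ i → wχ A i + wχ B i ≤ wχ m i + wχ M i
    wχ-∪-≤-extremals i with i ∈? A | i ∈? B
    ... | yes i∈A | yes i∈B rewrite wχ-∈ i∈A | wχ-∈ i∈B
      | wχ-∈ {m} (proj₁ (∩-⊆-minimals∩maximals A-anti B-anti i∈A i∈B))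
      | wχ-∈ {M} (proj₂ (∩-⊆-minimals∩maximals A-anti B-anti i∈A i∈B)) = ≤-refl
    ... | yes i∈A | no i∉B  rewrite wχ-∈ i∈A | wχ-∉ i∉B | +-identityʳ (w i) = covered (x∈p∪q⁺ (inj₁ i∈A))
    ... | no i∉A  | yes i∈B rewrite wχ-∉ i∉A | wχ-∈ i∈B | +-identityˡ (w i) = covered (x∈p∪q⁺ (inj₂ i∈B))
    ... | no i∉A  | no i∉B  rewrite wχ-∉ i∉A | wχ-∉ i∉B = +-mono-≤ (m≥0 i) (M≥0 i)

  ∪-weight-nonneg : ∀ {A B i} → Vertex A → Vertex B → i ∈ A ∪ B → 0ℤ ≤ w i
  ∪-weight-nonneg {A} {B} VA VB i∈ with x∈p∪q⁻ A B i∈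
  ... | inj₁ i∈A = weight-nonneg VA i∈A
  ... | inj₂ i∈B = weight-nonneg VB i∈B

  extremals-∪-vertex : ∀ {A B} → Vertex A → Vertex B → Vertex (minimals (A ∪ B)) × Vertex (maximals (A ∪ B))
  extremals-∪-vertex {A} {B} VA@(A-anti , A-opt) VB@(B-anti , B-opt) =
    vertex-≤ VA (minimals-antichain _) (proj₁ squeezed) , vertex-≤ VB (maximals-antichain _) (proj₂ squeezed)
    where
      squeezed = ≤-+-squeeze (A-opt _ (minimals-antichain _)) (B-opt _ (maximals-antichain _))
                   (pairing-+-mono-≤ {A} {B} {minimals (A ∪ B)} {maximals (A ∪ B)}
                      (wχ-∪-≤-extremals A-anti B-anti (∪-weight-nonneg VA VB)))

  extremals-∪₃-vertex : ∀ {X Y Z} → Vertex X → Vertex Y → Vertex Z →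
                        Vertex (minimals (X ∪ Y ∪ Z)) × Vertex (maximals (X ∪ Y ∪ Z))
  extremals-∪₃-vertex {X} {Y} {Z} VX VY VZ =
    subst Vertex (Min.minimals-∪₃ X Y Z) (proj₁ (extremals-∪-vertex (proj₁ VXY) VZ)) ,
    subst Vertex (Max.minimals-∪₃ X Y Z) (proj₂ (extremals-∪-vertex (proj₂ VXY) VZ))
    where
      VXY = extremals-∪-vertex VX VY

  ⊕₃-vertex : ∀ {X Y Z} → Antichain P (X ∪ Y ∪ Z) → Vertex X → Vertex Y → Vertex Z → Vertex (X ⊕ Y ⊕ Z)
  ⊕₃-vertex {X} {Y} {Z} U-anti VX VY VZ = vertex-≤ {X} {D} VX (antichain-⊆ (⊕₃⊆∪₃ X Y Z) U-anti)
    (pairing-mono-≤ {X} {D} λ i → wχ-mono {X} {D} i (lost i) (gained i))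
    where
      D = X ⊕ Y ⊕ Z

      vertex : ∀ {V} → Among X Y Z V → Vertex V
      vertex = Among-elim Vertex VX VY VZ

      missing : ∀ {V i} → Among X Y Z V → i ∈ X ∪ Y ∪ Z → i ∉ V → w i ≤ 0ℤ
      missing V∈ i∈U i∉V =
        weight-nonpos (vertex V∈) i∉V (antichain-⊆ (p⊆q∧x∈q⇒p∪⁅x⁆⊆q (∈-∪₃⁺ V∈) i∈U) U-anti)

      lost : ∀ i → i ∈ X → i ∉ D → w i ≤ 0ℤ
      lost i i∈X i∉D with i ∈? Y | i ∈? Z
      ... | no i∉Y  | _       = missing 2nd (∈-∪₃⁺ 1st i∈X) i∉Y
      ... | yes _   | no i∉Z  = missing 3rd (∈-∪₃⁺ 1st i∈X) i∉Z
      ... | yes i∈Y | yes i∈Z = contradiction (∩₃⊆⊕₃ X Y Z i∈X i∈Y i∈Z) i∉D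

      gained : ∀ i → i ∉ X → i ∈ D → 0ℤ ≤ w i
      gained i _ i∈D with ∈-∪₃⁻ X Y Z (⊕₃⊆∪₃ X Y Z i∈D)
      ... | _ , V∈ , i∈V = weight-nonneg (vertex V∈) i∈V

  extremals-distinct : ∀ {X Y Z} → X ≢ Y → Y ≢ Z → X ≢ Z → Vertex X → Vertex Y → Vertex Z →
                       (∀ D → Vertex D → Among X Y Z D) → minimals (X ∪ Y ∪ Z) ≢ maximals (X ∪ Y ∪ Z)
  extremals-distinct X≢Y Y≢Z X≢Z VX VY VZ complete m≡M =
    ⊕₃-∉ _ _ _ X≢Y Y≢Z X≢Z (complete _ (⊕₃-vertex (minimals≡maximals⇒antichain m≡M) VX VY VZ))

  goodTriple-unique : ∀ {A B C A′ B′ C′} → GoodTriple P w A′ B′ C′ → GoodTriple P w A B C →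
                      B ≢ A → B ≢ C → A′ ≡ A × B′ ≡ B × C′ ≡ C
  goodTriple-unique {A} {B} {C} {A′} {B′} {C′}
    (_ , _ , _ , conv′ , A′-min , C′-max) (_ , _ , _ , conv , A-min , C-max) B≢A B≢C = A′≡A , B′≡B , C′≡C
    where
      U′≡U : A′ ∪ B′ ∪ C′ ≡ A ∪ B ∪ C
      U′≡U = ∪₃-cong (⇔.trans (⇔.sym (conv′ _)) (conv _))

      A′≡A : A′ ≡ A
      A′≡A = trans (Min.minimals-unique (subst (IsMinOf P A′) U′≡U A′-min)) (sym (Min.minimals-unique A-min))

      C′≡C : C′ ≡ C
      C′≡C = trans (Max.minimals-unique (subst (IsMaxOf P C′) U′≡U C′-max)) (sym (Max.minimals-unique C-max))

      B′≡B : B′ ≡ B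
      B′≡B with to (conv′ B) (from (conv B) 2nd)
      ... | inj₁ B≡A′        = contradiction (trans B≡A′ A′≡A) B≢A
      ... | inj₂ (inj₁ B≡B′) = sym B≡B′
      ... | inj₂ (inj₂ B≡C′) = contradiction (trans B≡C′ C′≡C) B≢C

  goodTriple-∩⊆ : ∀ {A B C} → GoodTriple P w A B C → A ≢ C → A ∩ C ⊆ B
  goodTriple-∩⊆ {A} {B} {C} (_ , B-anti , _ , conv , A-min , C-max) A≢C {p} p∈A∩C with p ∈? B
  ... | yes p∈B = p∈B
  ... | no p∉B  = contradiction (x∈p∧x∈q∧p-x≡q-x⇒p≡q p∈A p∈C (trans (minus-p 1st) (sym (minus-p 3rd)))) A≢C
    where
      p∈A = proj₁ (x∈p∩q⁻ A C p∈A∩C)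
      p∈C = proj₂ (x∈p∩q⁻ A C p∈A∩C)

      wp≤0 : w p ≤ 0ℤ
      wp≤0 = weight-nonpos (from (conv B) 2nd) p∉B
        (antichain-∪⁅isolated⁆ B-anti (∈-∪₃⁺ 2nd) (to (A-min p) p∈A) (to (C-max p) p∈C))

      minus-p : ∀ {D} → Among A B C D → D - p ≡ B
      minus-p {D} D∈ with to (conv (D - p)) (vertex-minus (from (conv D) D∈) wp≤0)
      ... | inj₁ D-p≡A        = contradiction (subst (p ∈_) (sym D-p≡A) p∈A) (x∉p-x p)
      ... | inj₂ (inj₁ D-p≡B) = D-p≡B
      ... | inj₂ (inj₂ D-p≡C) = contradiction (subst (p ∈_) (sym D-p≡C) p∈C) (x∉p-x p)

  triangle⇒goodTriple : TriangularFace P w →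
                        ∃[ A ] ∃[ B ] ∃[ C ] GoodTriple P w A B C × A ≢ B × B ≢ C × A ≢ C
  triangle⇒goodTriple (X , Y , Z , X≢Y , Y≢Z , X≢Z , VX , VY , VZ , complete) =
    with-third (Among-third X≢Y Y≢Z X≢Z (complete m Vm) (complete M VM) m≢M)
    where
      U = X ∪ Y ∪ Z
      m = minimals U
      M = maximals U
      Vm = proj₁ (extremals-∪₃-vertex VX VY VZ)
      VM = proj₂ (extremals-∪₃-vertex VX VY VZ)
      m≢M = extremals-distinct X≢Y Y≢Z X≢Z VX VY VZ complete

      vertex : ∀ {D} → Among X Y Z D → Vertex D
      vertex = Among-elim Vertex VX VY VZ

      with-third : ∃[ B ] B ≢ m × B ≢ M × (∀ {D} → Among X Y Z D ⇔ Among m B M D) →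
                   ∃[ A ] ∃[ B ] ∃[ C ] GoodTriple P w A B C × A ≢ B × B ≢ C × A ≢ C
      with-third (B , B≢m , B≢M , same) =
        m , B , M , (proj₁ Vm , proj₁ (vertex (from same 2nd)) , proj₁ VM , conv , m-min , M-max) ,
        B≢m ∘ sym , B≢M , m≢M
        where
          conv : FaceIsConv P w m B M
          conv D = mk⇔ (to same ∘ complete D) (vertex ∘ from same)

          m-min : IsMinOf P m (m ∪ B ∪ M)
          m-min = subst (IsMinOf P m) (∪₃-cong same) (λ _ → Min.∈-minimals)

          M-max : IsMaxOf P M (m ∪ B ∪ M)
          M-max = subst (IsMaxOf P M) (∪₃-cong same) (λ _ → Max.∈-minimals)

lemma4p3 : (P : FinPoset) (w : Fin (FinPoset.size P) → ℤ) → TriangularFace P w →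
    Σ (Subset (FinPoset.size P)) λ A → Σ (Subset (FinPoset.size P)) λ B → Σ (Subset (FinPoset.size P)) λ C →
    GoodTriple P w A B C ×
    (∀ A′ B′ C′ → GoodTriple P w A′ B′ C′ → (A′ ≡ A) × (B′ ≡ B) × (C′ ≡ C)) ×
    (A ∩ C ⊆ B)
lemma4p3 P w triangle =
  let open Face P w
      (A , B , C , good , A≢B , B≢C , A≢C) = triangle⇒goodTriple triangle
  in A , B , C , good ,
     (λ _ _ _ good′ → goodTriple-unique good′ good (A≢B ∘ sym) B≢C) ,
     goodTriple-∩⊆ good A≢C
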